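{- For every prime $p$: (i) $\{(r,e,d)\in\mathscr{U}(p): d=r\}=\mathscr{B}_+(p)$; (ii) $\{(r,e,d)\in\mathscr{U}(p): d=r-1\}=\mathscr{B}_0(p)$; (iii) $\{(r,e,d)\in\mathscr{U}(p): r=2\}=\{(r,e,d)\in\mathscr{B}(p): r=2\}$.
   Context: For integers $(r,e,d)$ put $g=\left\{red-\frac{d(d+1)}{2}(p-1)\right\}\Big/\frac{r(r-1)}{2}$. $\mathscr{U}(p)$ is the set of $(r,e,d)\in\mathbb{Z}^3$ with $r\ge2$, $e\ge1$, $1\le d\le p$, $d(p-1)\le re\le r(p-1)$, $g>0$, and $g\in2\mathbb{Z}$ when $p\ne2$, $g\in\mathbb{Z}$ when $p=2$. $\mathscr{B}_+(p)=\{(r,e,d)\in\mathbb{Z}^3: 2\le r\le p,\ e=p-1,\ d=r\}$, $\mathscr{B}_0(p)=\{(r,e,d)\in\mathbb{Z}^3: 2\le r\le p+1,\ (p-1)/2<e\le p-1,\ r(p-1-e)\le p-1,\ d=r-1\}$, $\mathscr{B}_-(p)=\{(r,e,d)\in\mathbb{Z}^3: r\ge2,\ (p-1)/2<e\le p-1,\ r(p-1-e)=p-1,\ d=r-2\}$, and $\mathscr{B}(p)=\mathscr{B}_+(p)\cup\mathscr{B}_0(p)\cup\mathscr{B}_-(p)$. -}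

module Defs where

open import Data.Nat using (ℕ)
open import Data.Integer using (ℤ; +_; _+_; _-_; _*_; _≤_; _<_; _≥_; 0ℤ; 1ℤ)
open import Data.Product using (Σ; _×_)
open import Relation.Binary.PropositionalEquality using (_≡_; _≢_)

P : ℕ → ℤ
P p = + p

P-1 : ℕ → ℤ
P-1 p = + p - 1ℤ

-- g = (r e d - d(d+1)/2 (p-1)) / (r(r-1)/2)
--   = gNum / gDen  with
gNum : ℕ → ℤ → ℤ → ℤ → ℤ
gNum p r e d = + 2 * r * e * d - d * (d + 1ℤ) * P-1 p

gDen : ℤ → ℤ
gDen r = r * (r - 1ℤ)

-- "g = k" for an integer k (cleared denominators; gDen r > 0 whenever r ≥ 2)
GEq : ℕ → ℤ → ℤ → ℤ → ℤ → Set
GEq p r e d k = k * gDen r ≡ gNum p r e d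

GInt : ℕ → ℤ → ℤ → ℤ → Set
GInt p r e d = Σ ℤ (λ k → GEq p r e d k)

GEven : ℕ → ℤ → ℤ → ℤ → Set
GEven p r e d = Σ ℤ (λ k → GEq p r e d (+ 2 * k))

-- g > 0 (given gDen r > 0, i.e. r ≥ 2, this is gNum > 0)
GPos : ℕ → ℤ → ℤ → ℤ → Set
GPos p r e d = 0ℤ < gNum p r e d

U : ℕ → ℤ → ℤ → ℤ → Set
U p r e d =
  (+ 2 ≤ r) × (1ℤ ≤ e) × (1ℤ ≤ d) × (d ≤ P p) ×
  (d * P-1 p ≤ r * e) × (r * e ≤ r * P-1 p) ×
  GPos p r e d ×
  ((p ≢ 2 → GEven p r e d) × (p ≡ 2 → GInt p r e d))

B₊ : ℕ → ℤ → ℤ → ℤ → Set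
B₊ p r e d = (+ 2 ≤ r) × (r ≤ P p) × (e ≡ P-1 p) × (d ≡ r)

-- 𝓑₀(p);  (p-1)/2 < e  is written  p-1 < 2e
B₀ : ℕ → ℤ → ℤ → ℤ → Set
B₀ p r e d =
  (+ 2 ≤ r) × (r ≤ P p + 1ℤ) × (P-1 p < + 2 * e) × (e ≤ P-1 p) ×
  (r * (P-1 p - e) ≤ P-1 p) × (d ≡ r - 1ℤ)

B₋ : ℕ → ℤ → ℤ → ℤ → Set
B₋ p r e d =
  (+ 2 ≤ r) × (P-1 p < + 2 * e) × (e ≤ P-1 p) ×
  (r * (P-1 p - e) ≡ P-1 p) × (d ≡ r - + 2)

{-# OPTIONS --safe #-}
-- On the diagonal d = r the numerator of g is r(r-1)(p-1) and on the subdiagonal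
-- d = r-1 it is r(r-1)(2e-(p-1)), so there g = p-1 and g = 2e-(p-1) respectively.
-- Both are congruent to p-1 mod 2, hence even for odd p, and the remaining
-- conditions of 𝒰 become those of 𝓑₊ and 𝓑₀ after cancelling positive factors.
-- For r = 2 the bounds d(p-1) ≤ 2e ≤ 2(p-1) force d ∈ {r-1, r}, and 𝓑₋ has no
-- member with r = 2, since 2(p-1-e) = p-1 contradicts p-1 < 2e.
module Submission where

open import Defs
open import Data.Nat using (ℕ)
open import Data.Nat.Primality using (Prime)
open import Data.Integer using (ℤ; +_; _-_; 1ℤ)
open import Data.Product using (_×_)
open import Data.Sum using (_⊎_)
open import Function.Bundles using (_⇔_)
open import Relation.Binary.PropositionalEquality using (_≡_)

open import Data.Nat as ℕ using (suc; s≤s; z≤n; s≤s⁻¹; nonTrivial⇒n>1; _/_; _%_)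
open import Data.Nat.DivMod using (m≡m%n+[m/n]*n; m%n<n)
open import Data.Nat.Divisibility using (divides)
open import Data.Nat.Primality using (prime⇒irreducible; prime⇒nonTrivial)
open import Data.Integer
  using (0ℤ; -1ℤ; _+_; _*_; -_; _≤_; _<_; +≤+; +<+; positive; nonNegative; _≟_)
open import Data.Integer.Properties
open import Data.Integer.Tactic.RingSolver using (solve-∀)
open import Data.Product using (Σ; _,_; proj₁)
open import Data.Sum using (inj₁; inj₂; [_,_]′)
open import Data.Empty using (⊥-elim)
open import Function.Base using (_∘_)
open import Function.Bundles using (mk⇔; Equivalence)
open import Relation.Nullary using (yes; no)
open import Relation.Binary.PropositionalEquality
  using (refl; sym; trans; cong; subst; subst₂; _≢_; module ≡-Reasoning)

open Equivalence using (to; from)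

variable
  p : ℕ
  i j k l r e d : ℤ

prime∧≢2⇒odd : Prime p → p ≢ 2 → p ≡ suc (p / 2 ℕ.* 2)
prime∧≢2⇒odd {p} p-prime p≢2 with p % 2 | m≡m%n+[m/n]*n p 2 | m%n<n p 2
... | 0           | p≡[p/2]*2   | _ =
  ⊥-elim ([ (λ ()) , p≢2 ∘ sym ]′ (prime⇒irreducible p-prime (divides (p / 2) p≡[p/2]*2)))
... | 1           | p≡1+[p/2]*2 | _ = p≡1+[p/2]*2
... | suc (suc _) | _           | s≤s (s≤s ())

P-1-even : Prime p → p ≢ 2 → Σ ℤ (λ h → P-1 p ≡ + 2 * h)
P-1-even {p} p-prime p≢2 = + (p / 2) , (begin
  P-1 p                       ≡⟨ cong (λ n → + n - 1ℤ) (prime∧≢2⇒odd p-prime p≢2) ⟩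
  + suc (p / 2 ℕ.* 2) - 1ℤ    ≡⟨⟩
  + (p / 2 ℕ.* 2)             ≡⟨ pos-* (p / 2) 2 ⟩
  + (p / 2) * + 2             ≡⟨ *-comm (+ (p / 2)) (+ 2) ⟩
  + 2 * + (p / 2)             ∎)
  where open ≡-Reasoning

P-1-pos : Prime p → 0ℤ < P-1 p
P-1-pos {suc n} p-prime = +<+ (s≤s⁻¹ (nonTrivial⇒n>1 (suc n) {{prime⇒nonTrivial p-prime}}))
P-1-pos {0} p-prime with () ← nonTrivial⇒n>1 0 {{prime⇒nonTrivial p-prime}}

*-pos : 0ℤ < i → 0ℤ < j → 0ℤ < i * j
*-pos {i} 0<i 0<j = subst (_< i * _) (*-zeroʳ i) (*-monoˡ-<-pos i {{positive 0<i}} 0<j)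

*-pos⁻¹ʳ : 0ℤ < i → 0ℤ < i * j → 0ℤ < j
*-pos⁻¹ʳ {i} {j} 0<i 0<ij =
  *-cancelˡ-<-nonNeg i {{nonNegative (<⇒≤ 0<i)}} (subst (_< i * j) (sym (*-zeroʳ i)) 0<ij)

i<j⇔0<j-i : i < j ⇔ 0ℤ < j - i
i<j⇔0<j-i {i} {j} = mk⇔
  (λ i<j → subst (_< j - i) (+-inverseʳ i) (+-monoˡ-< (- i) i<j))
  (λ 0<j-i → subst₂ _<_ (+-identityˡ i) (j-i+i≡j j i) (+-monoˡ-< i 0<j-i))
  where
  j-i+i≡j : ∀ j i → j - i + i ≡ j
  j-i+i≡j = solve-∀

j-i≡l-k⇒i≤j⇔k≤l : j - i ≡ l - k → i ≤ j ⇔ k ≤ l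
j-i≡l-k⇒i≤j⇔k≤l eq = mk⇔ (transport eq) (transport (sym eq))
  where
  transport : j - i ≡ l - k → i ≤ j → k ≤ l
  transport eq i≤j = 0≤i-j⇒j≤i (subst (0ℤ ≤_) eq (i≤j⇒0≤j-i i≤j))

j-1≤i∧i≤j⇒i≡j-1⊎i≡j : j - 1ℤ ≤ i → i ≤ j → i ≡ j - 1ℤ ⊎ i ≡ j
j-1≤i∧i≤j⇒i≡j-1⊎i≡j {j = j} {i = i} j-1≤i i≤j with i ≟ j
... | yes i≡j = inj₂ i≡j
... | no  i≢j = inj₁ (≤-antisym i≤j-1 j-1≤i)
  where
  i≤j-1 : i ≤ j - 1ℤ
  i≤j-1 = subst (i ≤_) (+-comm -1ℤ j) (i<j⇒i≤pred[j] (≤∧≢⇒< i≤j i≢j))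

2≤i⇒0<i : + 2 ≤ i → 0ℤ < i
2≤i⇒0<i = <-≤-trans (+<+ (s≤s z≤n))

gDen-pos : + 2 ≤ r → 0ℤ < gDen r
gDen-pos 2≤r = *-pos (2≤i⇒0<i 2≤r) (to i<j⇔0<j-i (suc[i]≤j⇒i<j 2≤r))

module _ {p : ℕ} where

  GEq⇒GPos⇔0< : ∀ r e d k → + 2 ≤ r → GEq p r e d k → GPos p r e d ⇔ 0ℤ < k
  GEq⇒GPos⇔0< r e d k 2≤r g≡k = mk⇔
    (λ 0<gNum → *-pos⁻¹ʳ (gDen-pos 2≤r) (subst (0ℤ <_) (sym gDen*k≡gNum) 0<gNum))
    (λ 0<k → subst (0ℤ <_) gDen*k≡gNum (*-pos (gDen-pos 2≤r) 0<k))
    where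
    gDen*k≡gNum : gDen r * k ≡ gNum p r e d
    gDen*k≡gNum = trans (*-comm (gDen r) k) g≡k

  g-diagonal : ∀ r → GEq p r (P-1 p) r (P-1 p)
  g-diagonal r = identity r (P-1 p)
    where
    identity : ∀ r q → q * (r * (r - 1ℤ)) ≡ + 2 * r * q * r - r * (r + 1ℤ) * q
    identity = solve-∀

  g-subdiagonal : ∀ r e → GEq p r e (r - 1ℤ) (+ 2 * e - P-1 p)
  g-subdiagonal r e = identity r e (P-1 p)
    where
    identity : ∀ r e q →
      (+ 2 * e - q) * (r * (r - 1ℤ)) ≡ + 2 * r * e * (r - 1ℤ) - (r - 1ℤ) * (r - 1ℤ + 1ℤ) * q
    identity = solve-∀

  B₋⇒r≢2 : B₋ p r e d → r ≢ + 2
  B₋⇒r≢2 {e = e} (_ , q<2e , _ , 2[q-e]≡q , _) refl =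
    <-irrefl refl (subst (0ℤ <_) 2e-q≡0 (to i<j⇔0<j-i q<2e))
    where
    open ≡-Reasoning
    identity : ∀ e q → + 2 * e - q ≡ q - + 2 * (q - e)
    identity = solve-∀
    2e-q≡0 : + 2 * e - P-1 p ≡ 0ℤ
    2e-q≡0 = begin
      + 2 * e - P-1 p               ≡⟨ identity e (P-1 p) ⟩
      P-1 p - + 2 * (P-1 p - e)     ≡⟨ cong (λ x → P-1 p - x) 2[q-e]≡q ⟩
      P-1 p - P-1 p                 ≡⟨ +-inverseʳ (P-1 p) ⟩
      0ℤ                            ∎

  module _ (p-prime : Prime p) where

    g-integrality : ∀ r e d m → GEq p r e d (P-1 p + + 2 * m) →
      (p ≢ 2 → GEven p r e d) × (p ≡ 2 → GInt p r e d)
    g-integrality r e d m g≡q+2m = even , λ _ → P-1 p + + 2 * m , g≡q+2m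
      where
      even : p ≢ 2 → GEven p r e d
      even p≢2 with h , q≡2h ← P-1-even p-prime p≢2 =
        h + m , subst (GEq p r e d) q+2m≡2[h+m] g≡q+2m
        where
        q+2m≡2[h+m] : P-1 p + + 2 * m ≡ + 2 * (h + m)
        q+2m≡2[h+m] = trans (cong (_+ + 2 * m) q≡2h) (sym (*-distribˡ-+ (+ 2) h m))

    U⇒d≤r : U p r e d → d ≤ r
    U⇒d≤r {r = r} {d = d} (_ , _ , _ , _ , dq≤re , re≤rq , _) =
      *-cancelʳ-≤-pos d r (P-1 p) {{positive (P-1-pos p-prime)}} (≤-trans dq≤re re≤rq)

    U-diagonal⇔B₊ : (U p r e d × d ≡ r) ⇔ B₊ p r e d
    U-diagonal⇔B₊ {r = r} = mk⇔
      (λ { ((2≤r , _ , _ , r≤p , rq≤re , re≤rq , _) , refl) →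
           2≤r , r≤p , ≤-antisym (cancel 2≤r re≤rq) (cancel 2≤r rq≤re) , refl })
      (λ { (2≤r , r≤p , refl , refl) →
           ( 2≤r , i<j⇒suc[i]≤j (P-1-pos p-prime) , ≤-trans (+≤+ (s≤s z≤n)) 2≤r , r≤p
           , ≤-refl , ≤-refl
           , from (GEq⇒GPos⇔0< r q r q 2≤r (g-diagonal r)) (P-1-pos p-prime)
           , g-integrality r q r 0ℤ (subst (GEq p r q r) (sym (+-identityʳ q)) (g-diagonal r)) )
           , refl })
      where
      q : ℤ
      q = P-1 p
      cancel : + 2 ≤ r → r * i ≤ r * j → i ≤ j
      cancel {i = i} {j = j} 2≤r = *-cancelˡ-≤-pos i j r {{positive (2≤i⇒0<i 2≤r)}}

    U-subdiagonal⇔B₀ : (U p r e d × d ≡ r - 1ℤ) ⇔ B₀ p r e d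
    U-subdiagonal⇔B₀ {r = r} {e = e} = mk⇔
      (λ { ((2≤r , _ , _ , r-1≤p , lower , upper , g>0 , _) , refl) →
           2≤r , to r-1≤p⇔r≤p+1 r-1≤p
           , from i<j⇔0<j-i (to (g>0⇔ 2≤r) g>0)
           , *-cancelˡ-≤-pos e q r {{positive (2≤i⇒0<i 2≤r)}} upper
           , to lower⇔ lower , refl })
      (λ { (2≤r , r≤p+1 , q<2e , e≤q , r[q-e]≤q , refl) →
           ( 2≤r , i<j⇒suc[i]≤j (0<e q<2e) , +-monoˡ-≤ -1ℤ 2≤r , from r-1≤p⇔r≤p+1 r≤p+1
           , from lower⇔ r[q-e]≤q
           , *-monoˡ-≤-nonNeg r {{nonNegative (<⇒≤ (2≤i⇒0<i 2≤r))}} e≤q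
           , from (g>0⇔ 2≤r) (to i<j⇔0<j-i q<2e)
           , g-integrality r e (r - 1ℤ) (e - q)
               (subst (GEq p r e (r - 1ℤ)) (2e-q≡q+2[e-q] e q) (g-subdiagonal r e)) )
           , refl })
      where
      q : ℤ
      q = P-1 p
      g>0⇔ : + 2 ≤ r → GPos p r e (r - 1ℤ) ⇔ 0ℤ < + 2 * e - q
      g>0⇔ 2≤r = GEq⇒GPos⇔0< r e (r - 1ℤ) (+ 2 * e - q) 2≤r (g-subdiagonal r e)
      r-1≤p⇔r≤p+1 : r - 1ℤ ≤ P p ⇔ r ≤ P p + 1ℤ
      r-1≤p⇔r≤p+1 = j-i≡l-k⇒i≤j⇔k≤l (identity r (P p))
        where
        identity : ∀ r p → p - (r - 1ℤ) ≡ p + 1ℤ - r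
        identity = solve-∀
      lower⇔ : (r - 1ℤ) * q ≤ r * e ⇔ r * (q - e) ≤ q
      lower⇔ = j-i≡l-k⇒i≤j⇔k≤l (identity r e q)
        where
        identity : ∀ r e q → r * e - (r - 1ℤ) * q ≡ q - r * (q - e)
        identity = solve-∀
      2e-q≡q+2[e-q] : ∀ e q → + 2 * e - q ≡ q + + 2 * (e - q)
      2e-q≡q+2[e-q] = solve-∀
      0<e : q < + 2 * e → 0ℤ < e
      0<e q<2e = *-cancelˡ-<-nonNeg (+ 2) (<-trans (P-1-pos p-prime) q<2e)

    U-r≡2⇔B : (U p r e d × r ≡ + 2) ⇔ ((B₊ p r e d ⊎ B₀ p r e d ⊎ B₋ p r e d) × r ≡ + 2)
    U-r≡2⇔B = mk⇔ classify include
      where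
      classify : U p r e d × r ≡ + 2 → (B₊ p r e d ⊎ B₀ p r e d ⊎ B₋ p r e d) × r ≡ + 2
      classify (u@(_ , _ , 1≤d , _) , refl) with j-1≤i∧i≤j⇒i≡j-1⊎i≡j 1≤d (U⇒d≤r u)
      ... | inj₁ d≡1 = inj₂ (inj₁ (to U-subdiagonal⇔B₀ (u , d≡1))) , refl
      ... | inj₂ d≡2 = inj₁ (to U-diagonal⇔B₊ (u , d≡2)) , refl
      include : (B₊ p r e d ⊎ B₀ p r e d ⊎ B₋ p r e d) × r ≡ + 2 → U p r e d × r ≡ + 2
      include (inj₁ b₊ , r≡2)        = proj₁ (from U-diagonal⇔B₊ b₊) , r≡2
      include (inj₂ (inj₁ b₀) , r≡2) = proj₁ (from U-subdiagonal⇔B₀ b₀) , r≡2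
      include (inj₂ (inj₂ b₋) , r≡2) = ⊥-elim (B₋⇒r≢2 b₋ r≡2)

lemma5 : (p : ℕ) → Prime p →
    ((r e d : ℤ) → (U p r e d × d ≡ r) ⇔ B₊ p r e d) ×
    ((r e d : ℤ) → (U p r e d × d ≡ r - 1ℤ) ⇔ B₀ p r e d) ×
    ((r e d : ℤ) →
      (U p r e d × r ≡ + 2) ⇔ ((B₊ p r e d ⊎ B₀ p r e d ⊎ B₋ p r e d) × r ≡ + 2))
lemma5 p p-prime =
  (λ _ _ _ → U-diagonal⇔B₊ p-prime) ,
  (λ _ _ _ → U-subdiagonal⇔B₀ p-prime) ,
  (λ _ _ _ → U-r≡2⇔B p-prime)
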